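{- Let $G$ be a 3-edge-connected near-bipartite cubic graph and let $C=\partial(X)$ be a non-trivial 3-edge cut of $G$. Then $C$ is tight if and only if one of the two graphs $G/X$ and $G/\overline{X}$ is bipartite.
   Context: All graphs are finite, simple and undirected. A connected graph is matching covered if every edge lies in some perfect matching. A non-bipartite matching covered graph $G$ is near-bipartite if $G-\{e,f\}$ is bipartite and matching covered for some edges $e,f$. $\partial(X)$ is the set of edges with exactly one end in $X$; it is non-trivial if $|X|\geq 2$ and $|\overline{X}|\geq 2$ ($\overline{X}=V(G)\setminus X$), and tight if every perfect matching of $G$ contains exactly one edge of it. $G/X$ is the graph obtained by contracting $X$ to a single vertex. -}

module Defs where

open import Data.Nat using (ℕ; _≤_)
open import Data.Fin using (Fin; _≟_)
open import Data.Fin.Properties using ()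
open import Data.Bool using (Bool; true; false; _∧_; _∨_; not)
open import Data.List using (List; length; filterᵇ; allFin; cartesianProduct)
open import Data.Maybe using (Maybe; just; nothing)
open import Data.Product using (Σ; ∃; _×_; _,_; proj₁; proj₂)
open import Data.Empty using (⊥)
open import Relation.Nullary using (¬_)
open import Relation.Nullary.Decidable using (⌊_⌋)
open import Relation.Binary.PropositionalEquality using (_≡_)

Adj : ℕ → Set
Adj n = Fin n → Fin n → Bool

record IsSimple {n : ℕ} (A : Adj n) : Set where
  field
    symm   : ∀ u v → A u v ≡ A v u
    irrefl : ∀ u → A u u ≡ false

VSet : ℕ → Set
VSet n = Fin n → Bool

size : ∀ {n} → VSet n → ℕ
size {n} X = length (filterᵇ X (allFin n))

complement : ∀ {n} → VSet n → VSet n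
complement X v = not (X v)

degree : ∀ {n} → Adj n → Fin n → ℕ
degree {n} A u = length (filterᵇ (A u) (allFin n))

Cubic : ∀ {n} → Adj n → Set
Cubic A = ∀ u → degree A u ≡ 3

data Reach {n : ℕ} (A : Adj n) (u : Fin n) : Fin n → Set where
  here : Reach A u u
  step : ∀ {v w} → Reach A u v → A v w ≡ true → Reach A u w

Connected : ∀ {n} → Adj n → Set
Connected A = ∀ u v → Reach A u v

isPair : ∀ {n} → Fin n → Fin n → Fin n → Fin n → Bool
isPair a b u v = (⌊ a ≟ u ⌋ ∧ ⌊ b ≟ v ⌋) ∨ (⌊ a ≟ v ⌋ ∧ ⌊ b ≟ u ⌋)

delete2 : ∀ {n} → Adj n → Fin n → Fin n → Fin n → Fin n → Adj n
delete2 A a b c d u v = A u v ∧ not (isPair a b u v ∨ isPair c d u v)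

-- 3-edge-connected: connected after deleting any at most two edges
-- (choosing non-edges or repeated pairs covers deleting fewer edges).
ThreeEdgeConnected : ∀ {n} → Adj n → Set
ThreeEdgeConnected A = ∀ a b c d → Connected (delete2 A a b c d)

BipartiteRel : {V : Set} → (V → V → Set) → Set
BipartiteRel {V} R = Σ (V → Bool) λ c → ∀ u v → R u v → ¬ (c u ≡ c v)

Bipartite : ∀ {n} → Adj n → Set
Bipartite A = BipartiteRel (λ u v → A u v ≡ true)

record PerfectMatching {n : ℕ} (A : Adj n) (M : Adj n) : Set where
  field
    sub    : ∀ u v → M u v ≡ true → A u v ≡ true
    symm   : ∀ u v → M u v ≡ M v u
    exact1 : ∀ u → degree M u ≡ 1

MatchingCovered : ∀ {n} → Adj n → Set
MatchingCovered {n} A =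
  Connected A ×
  (∀ u v → A u v ≡ true → Σ (Adj n) λ M → PerfectMatching A M × M u v ≡ true)

NearBipartite : ∀ {n} → Adj n → Set
NearBipartite {n} A =
  ¬ Bipartite A × MatchingCovered A ×
  Σ (Fin n) λ a → Σ (Fin n) λ b → Σ (Fin n) λ c → Σ (Fin n) λ d →
    A a b ≡ true × A c d ≡ true ×
    Bipartite (delete2 A a b c d) × MatchingCovered (delete2 A a b c d)

-- Number of edges of the (symmetric) edge set B lying in ∂(X):
-- ordered pairs (u,v) with u ∈ X, v ∉ X, B u v (each edge counted once).
cutCount : ∀ {n} → VSet n → Adj n → ℕ
cutCount {n} X B =
  length (filterᵇ (λ p → X (proj₁ p) ∧ not (X (proj₂ p)) ∧ B (proj₁ p) (proj₂ p))
                  (cartesianProduct (allFin n) (allFin n)))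

NonTrivial : ∀ {n} → VSet n → Set
NonTrivial X = 2 ≤ size X × 2 ≤ size (complement X)

Tight : ∀ {n} → Adj n → VSet n → Set
Tight {n} A X = ∀ (M : Adj n) → PerfectMatching A M → cutCount X M ≡ 1

-- Contraction G/X: vertices are the vertices outside X plus one new vertex
-- (nothing) representing X; edges inside X disappear, and edge multiplicity
-- is forgotten (irrelevant for bipartiteness).
ContrV : ∀ {n} → VSet n → Set
ContrV {n} X = Maybe (Σ (Fin n) λ v → X v ≡ false)

contractAdj : ∀ {n} → Adj n → (X : VSet n) → ContrV X → ContrV X → Set
contractAdj A X nothing nothing = ⊥
contractAdj {n} A X nothing (just (v , _)) = Σ (Fin n) λ u → X u ≡ true × A u v ≡ true
contractAdj {n} A X (just (u , _)) nothing = Σ (Fin n) λ v → X v ≡ true × A u v ≡ true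
contractAdj A X (just (u , _)) (just (v , _)) = A u v ≡ true

-- For a spanning subgraph F and signs s : V → {±1}, sum deg_F(u) · s(u) over a vertex set S
-- edge by edge: an edge of F inside S contributes s(u) + s(v), which vanishes where s comes
-- from a proper 2-colouring, and an edge of F leaving S contributes the sign of its end in S.
--
-- If G/Y is bipartite, sign each vertex outside Y by whether its colour differs from that of
-- the contracted vertex. Then every edge of F leaving the complement of Y counts +1, so for a
-- d-regular F the sum D of these signs satisfies d · D = |∂(Y) ∩ F|. Taking F = G gives D = 1,
-- and then every perfect matching F meets ∂(Y) once.
--
-- Conversely, let κ properly colour the bipartite, matching covered H = G - pq - rt. A perfect
-- matching of H shows that the two colour classes have the same size, so every perfect matching
-- of G has as many edges inside one class as inside the other; a perfect matching through pq
-- thus forces rt to have both ends in the other class when κ p = κ q. Since G is not bipartite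
-- we may take κ = +1 on p, q and κ = -1 on r, t. Tightness makes D = ∑_{u ∈ X} κ u equal to the
-- colour of the X-end of every edge of H leaving X (use a perfect matching of H through it);
-- normalise D = 1. Counting for F = G then gives 3 = |∂(X) ∩ H| + [p ∈ X] + [q ∈ X] - [r ∈ X]
-- - [t ∈ X], while |∂(X)| = 3 is |∂(X) ∩ H| plus the crossings of pq and rt. Comparing leaves
-- [p, q ∈ X] = [r ∈ X or t ∈ X], and in either case κ properly colours G/X or G/X̄.

module Submission where

open import Defs
open import Data.Bool using (Bool; true; false; _∧_; _∨_; not; _xor_; T?)
open import Data.Bool.Properties
  using (T-≡; ∧-conicalˡ; ∧-conicalʳ; ∨-conicalˡ; ∨-conicalʳ; ∨-comm; not-injective; not-¬; xor-inverseˡ)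
  renaming (_≟_ to _≟ᵇ_)
open import Axiom.UniquenessOfIdentityProofs using (module Decidable⇒UIP)
open import Data.Empty using (⊥; ⊥-elim)
open import Data.Fin using (Fin; zero; suc; _≟_)
open import Data.Integer using (ℤ; +_; -[1+_]; _+_; _*_)
import Data.Integer.Properties as ℤP
open import Data.Integer.Tactic.RingSolver using (solve-∀)
open import Data.List using (List; []; _∷_; _++_; map; length; filterᵇ; allFin; tabulate; cartesianProduct)
open import Data.List.Membership.Propositional using (_∈_)
open import Data.List.Membership.Propositional.Properties
  using (∈-filter⁺; ∈-cartesianProduct⁺; ∈-allFin; ∈-length)
open import Data.List.Relation.Unary.Any using (here)
open import Data.Maybe using (just; nothing)
open import Data.Nat as ℕ using (ℕ; zero; suc; _<_; s≤s)
import Data.Nat.Properties as ℕP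
open import Data.Product using (Σ; ∃₂; _×_; _,_; proj₁; proj₂)
open import Data.Sum using (_⊎_; inj₁; inj₂; swap; [_,_])
open import Function using (_∘_; flip)
open import Function.Bundles using (_⇔_; Equivalence; mk⇔)
open import Relation.Binary.PropositionalEquality
  using (_≡_; _≢_; refl; sym; trans; cong; cong₂; subst; subst₂; module ≡-Reasoning)
open import Relation.Nullary using (¬_)
open import Relation.Nullary.Decidable using (⌊_⌋; does; yes; no; isYes≗does)

open import Algebra.Properties.AbelianGroup ℤP.+-0-abelianGroup using (∙-cancelˡ)
open import Algebra.Properties.Semiring.Sum ℤP.+-*-semiring
  using (sum; ∑-distrib-+; ∑-comm; *-distribˡ-sum; sum-cong-≗; sum-replicate-zero)

Bool-UIP : ∀ {x y : Bool} (p q : x ≡ y) → p ≡ q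
Bool-UIP = Decidable⇒UIP.≡-irrelevant _≟ᵇ_

true≢false : true ≢ false
true≢false ()

false≢true : false ≢ true
false≢true ()

∧-true : ∀ {x y} → x ∧ y ≡ true → x ≡ true × y ≡ true
∧-true {x} {y} e = ∧-conicalˡ x y e , ∧-conicalʳ x y e

∧-false : ∀ {x y} → (x ≡ true → y ≡ true → ⊥) → x ∧ y ≡ false
∧-false {true}  {true}  contra = ⊥-elim (contra refl refl)
∧-false {true}  {false} _      = refl
∧-false {false}         _      = refl

∨-true : ∀ {x y} → x ∨ y ≡ true → x ≡ true ⊎ y ≡ true
∨-true {true}  _ = inj₁ refl
∨-true {false} e = inj₂ e

∨₃-true : ∀ {x y z} → x ∨ y ∨ z ≡ true → x ≡ true ⊎ y ≡ true ⊎ z ≡ true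
∨₃-true {x} e with ∨-true {x} e
... | inj₁ x≡true = inj₁ x≡true
... | inj₂ e′     = inj₂ (∨-true e′)

not-true : ∀ {x} → not x ≡ true → x ≡ false
not-true {false} _ = refl

not-false : ∀ {x} → not x ≡ false → x ≡ true
not-false {true} _ = refl

xorˡ-≢ : ∀ {x y} z → x ≢ y → z xor x ≢ z xor y
xorˡ-≢ true  x≢y = x≢y ∘ not-injective
xorˡ-≢ false x≢y = x≢y

≢⇒xor : ∀ {x y} → x ≢ y → x xor y ≡ true
≢⇒xor {true}  {true}  x≢y = ⊥-elim (x≢y refl)
≢⇒xor {true}  {false} _   = refl
≢⇒xor {false} {true}  _   = refl
≢⇒xor {false} {false} x≢y = ⊥-elim (x≢y refl)

xor≡false⇒≡ : ∀ {x y} → x xor y ≡ false → y ≡ x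
xor≡false⇒≡ {true}  {true}  _ = refl
xor≡false⇒≡ {false} {false} _ = refl

𝟙 : Bool → ℤ
𝟙 true  = + 1
𝟙 false = + 0

𝟙-∨₃ : ∀ {x y z} → x ∧ y ≡ false → x ∧ z ≡ false → y ∧ z ≡ false →
       𝟙 (x ∨ y ∨ z) ≡ 𝟙 x + 𝟙 y + 𝟙 z
𝟙-∨₃ {true}  {false} {false} _ _ _ = refl
𝟙-∨₃ {false} {true}  {false} _ _ _ = refl
𝟙-∨₃ {false} {false} {true}  _ _ _ = refl
𝟙-∨₃ {false} {false} {false} _ _ _ = refl
𝟙-∨₃ {true}  {true}  ()
𝟙-∨₃ {true}  {false} {true}  _ ()
𝟙-∨₃ {false} {true}  {true}  _ _ ()

sgn : Bool → ℤ
sgn true  = + 1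
sgn false = -[1+ 0 ]

sgn-cancel : ∀ {x y} → x ≢ y → sgn x + sgn y ≡ + 0
sgn-cancel {true}  {true}  x≢y = ⊥-elim (x≢y refl)
sgn-cancel {true}  {false} _   = refl
sgn-cancel {false} {true}  _   = refl
sgn-cancel {false} {false} x≢y = ⊥-elim (x≢y refl)

sgn≡1⇒true : ∀ {x} → sgn x ≡ + 1 → x ≡ true
sgn≡1⇒true {true} _ = refl

x+x≡0⇒x≡0 : ∀ {x} → x + x ≡ + 0 → x ≡ + 0
x+x≡0⇒x≡0 {+ zero} _ = refl

∑₂ : ∀ {n} → (Fin n → Fin n → ℤ) → ℤ
∑₂ f = sum (λ u → sum (f u))

∑-zero : ∀ n → sum {n} (λ _ → + 0) ≡ + 0
∑-zero n = sum-replicate-zero n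

∑₂-zero : ∀ n → ∑₂ {n} (λ _ _ → + 0) ≡ + 0
∑₂-zero n = trans (sum-cong-≗ {n} (λ _ → ∑-zero n)) (∑-zero n)

∑₂-cong : ∀ {n} {f g : Fin n → Fin n → ℤ} → (∀ u v → f u v ≡ g u v) → ∑₂ f ≡ ∑₂ g
∑₂-cong f≗g = sum-cong-≗ (λ u → sum-cong-≗ (f≗g u))

∑₂-distrib-+ : ∀ {n} (f g : Fin n → Fin n → ℤ) → ∑₂ (λ u v → f u v + g u v) ≡ ∑₂ f + ∑₂ g
∑₂-distrib-+ f g =
  trans (sum-cong-≗ (λ u → ∑-distrib-+ (f u) (g u))) (∑-distrib-+ (λ u → sum (f u)) (λ u → sum (g u)))

-- Uses does rather than ⌊_⌋ so that δ (suc x) (suc u) reduces to δ x u.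
δ : ∀ {n} → Fin n → Fin n → Bool
δ x u = does (x ≟ u)

∑-δ : ∀ {n} (x : Fin n) (h : Fin n → ℤ) → sum (λ u → 𝟙 (δ x u) * h u) ≡ h x
∑-δ {suc n} zero h = begin
  + 1 * h zero + sum (λ u → + 0 * h (suc u))
    ≡⟨ cong₂ _+_ (ℤP.*-identityˡ (h zero)) (sum-cong-≗ {n} (λ u → ℤP.*-zeroˡ (h (suc u)))) ⟩
  h zero + sum {n} (λ _ → + 0) ≡⟨ cong (_+_ (h zero)) (∑-zero n) ⟩
  h zero + + 0                 ≡⟨ ℤP.+-identityʳ (h zero) ⟩
  h zero                       ∎
  where open ≡-Reasoning
∑-δ {suc n} (suc x) h = begin
  + 0 * h zero + sum (λ u → 𝟙 (δ x u) * h (suc u))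
    ≡⟨ cong₂ _+_ (ℤP.*-zeroˡ (h zero)) (∑-δ x (λ u → h (suc u))) ⟩
  + 0 + h (suc x) ≡⟨ ℤP.+-identityˡ (h (suc x)) ⟩
  h (suc x)       ∎
  where open ≡-Reasoning

∑₂-δ : ∀ {n} (x y : Fin n) (g : Fin n → Fin n → ℤ) →
       ∑₂ (λ u v → 𝟙 (δ x u) * (𝟙 (δ y v) * g u v)) ≡ g x y
∑₂-δ x y g = begin
  ∑₂ (λ u v → 𝟙 (δ x u) * (𝟙 (δ y v) * g u v))
    ≡⟨ sum-cong-≗ (λ u → *-distribˡ-sum (𝟙 (δ x u)) (λ v → 𝟙 (δ y v) * g u v)) ⟨
  sum (λ u → 𝟙 (δ x u) * sum (λ v → 𝟙 (δ y v) * g u v))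
    ≡⟨ ∑-δ x (λ u → sum (λ v → 𝟙 (δ y v) * g u v)) ⟩
  sum (λ v → 𝟙 (δ y v) * g x v) ≡⟨ ∑-δ y (g x) ⟩
  g x y                         ∎
  where open ≡-Reasoning

sumˡ : ∀ {A : Set} → List A → (A → ℤ) → ℤ
sumˡ []       g = + 0
sumˡ (x ∷ xs) g = g x + sumˡ xs g

sumˡ-++ : ∀ {A : Set} (xs ys : List A) g → sumˡ (xs ++ ys) g ≡ sumˡ xs g + sumˡ ys g
sumˡ-++ []       ys g = sym (ℤP.+-identityˡ (sumˡ ys g))
sumˡ-++ (x ∷ xs) ys g = trans (cong (_+_ (g x)) (sumˡ-++ xs ys g)) (sym (ℤP.+-assoc (g x) _ _))

sumˡ-map : ∀ {A B : Set} (f : A → B) (xs : List A) g → sumˡ (map f xs) g ≡ sumˡ xs (g ∘ f)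
sumˡ-map f []       g = refl
sumˡ-map f (x ∷ xs) g = cong (_+_ (g (f x))) (sumˡ-map f xs g)

sumˡ-tabulate : ∀ {A : Set} {n} (f : Fin n → A) g → sumˡ (tabulate f) g ≡ sum (g ∘ f)
sumˡ-tabulate {n = zero}  f g = refl
sumˡ-tabulate {n = suc n} f g = cong (_+_ (g (f zero))) (sumˡ-tabulate (f ∘ suc) g)

sumˡ-cartesianProduct : ∀ {A B : Set} (xs : List A) (ys : List B) g →
  sumˡ (cartesianProduct xs ys) g ≡ sumˡ xs (λ x → sumˡ ys (λ y → g (x , y)))
sumˡ-cartesianProduct []       ys g = refl
sumˡ-cartesianProduct (x ∷ xs) ys g =
  trans (sumˡ-++ (map (x ,_) ys) _ g) (cong₂ _+_ (sumˡ-map (x ,_) ys g) (sumˡ-cartesianProduct xs ys g))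

sumˡ-filterᵇ : ∀ {A : Set} (P : A → Bool) (xs : List A) g →
               sumˡ (filterᵇ P xs) g ≡ sumˡ xs (λ x → 𝟙 (P x) * g x)
sumˡ-filterᵇ P []       g = refl
sumˡ-filterᵇ P (x ∷ xs) g with P x
... | true  = cong₂ _+_ (sym (ℤP.*-identityˡ (g x))) (sumˡ-filterᵇ P xs g)
... | false = trans (sumˡ-filterᵇ P xs g) (sym (ℤP.+-identityˡ _))

sumˡ-singleton : ∀ {A : Set} {x : A} (xs : List A) g → length xs ≡ 1 → x ∈ xs → sumˡ xs g ≡ g x
sumˡ-singleton (x ∷ []) g _ (here refl) = ℤP.+-identityʳ (g x)

length-filterᵇ : ∀ {A : Set} (P : A → Bool) (xs : List A) → + length (filterᵇ P xs) ≡ sumˡ xs (𝟙 ∘ P)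
length-filterᵇ P []       = refl
length-filterᵇ P (x ∷ xs) with P x
... | true  = trans (ℤP.pos-+ 1 _) (cong (_+_ (+ 1)) (length-filterᵇ P xs))
... | false = trans (length-filterᵇ P xs) (sym (ℤP.+-identityˡ _))

length-filterᵇ-allFin : ∀ {n} (P : Fin n → Bool) → + length (filterᵇ P (allFin n)) ≡ sum (𝟙 ∘ P)
length-filterᵇ-allFin {n} P = trans (length-filterᵇ P (allFin n)) (sumˡ-tabulate (λ u → u) (𝟙 ∘ P))

filterᵇ-witness : ∀ {A : Set} (P : A → Bool) (xs : List A) →
                  0 < length (filterᵇ P xs) → Σ A λ x → P x ≡ true
filterᵇ-witness P (x ∷ xs) pos with P x in Px
... | true  = x , Px
... | false = filterᵇ-witness P xs pos

pairs : ∀ n → List (Fin n × Fin n)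
pairs n = cartesianProduct (allFin n) (allFin n)

sumˡ-pairs : ∀ {n} g → sumˡ (pairs n) g ≡ ∑₂ (λ u v → g (u , v))
sumˡ-pairs {n} g = begin
  sumˡ (pairs n) g
    ≡⟨ sumˡ-cartesianProduct (allFin n) (allFin n) g ⟩
  sumˡ (allFin n) (λ u → sumˡ (allFin n) (λ v → g (u , v)))
    ≡⟨ sumˡ-tabulate (λ u → u) (λ u → sumˡ (allFin n) (λ v → g (u , v))) ⟩
  sum (λ u → sumˡ (allFin n) (λ v → g (u , v)))
    ≡⟨ sum-cong-≗ (λ u → sumˡ-tabulate (λ v → v) (λ v → g (u , v))) ⟩
  ∑₂ (λ u v → g (u , v))
    ∎
  where open ≡-Reasoning

pairCount : ∀ {n} → (Fin n → Fin n → Bool) → ℕ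
pairCount {n} R = length (filterᵇ (λ p → R (proj₁ p) (proj₂ p)) (pairs n))

innerCount : ∀ {n} → VSet n → Adj n → ℕ
innerCount S F = pairCount (λ u v → S u ∧ S v ∧ F u v)

pairCount-∑₂ : ∀ {n} (R : Fin n → Fin n → Bool) → + pairCount R ≡ ∑₂ (λ u v → 𝟙 (R u v))
pairCount-∑₂ {n} R = trans (length-filterᵇ _ (pairs n)) (sumˡ-pairs (λ p → 𝟙 (R (proj₁ p) (proj₂ p))))

cutCount-∑₂ : ∀ {n} (S : VSet n) F → + cutCount S F ≡ ∑₂ (λ u v → 𝟙 (S u ∧ not (S v)) * 𝟙 (F u v))
cutCount-∑₂ S F = trans (pairCount-∑₂ (λ u v → S u ∧ not (S v) ∧ F u v))
                        (∑₂-cong (λ u v → 𝟙-∧-assoc (S u) (not (S v)) (F u v)))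
  where
  𝟙-∧-assoc : ∀ a b c → 𝟙 (a ∧ b ∧ c) ≡ 𝟙 (a ∧ b) * 𝟙 c
  𝟙-∧-assoc true  true  true  = refl
  𝟙-∧-assoc true  true  false = refl
  𝟙-∧-assoc true  false c     = refl
  𝟙-∧-assoc false b     c     = refl

pairCount-witness : ∀ {n} (R : Fin n → Fin n → Bool) → 0 < pairCount R → ∃₂ λ u v → R u v ≡ true
pairCount-witness {n} R pos with filterᵇ-witness _ (pairs n) pos
... | (u , v) , Ruv = u , v , Ruv

pairCount-zero : ∀ {n} (R : Fin n → Fin n → Bool) → (∀ u v → R u v ≡ true → ⊥) → pairCount R ≡ 0
pairCount-zero R none =
  ℕP.n≤0⇒n≡0 (ℕP.≮⇒≥ λ pos → let (u , v , Ruv) = pairCount-witness R pos in none u v Ruv)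

∈-filter-pairs : ∀ {n} (R : Fin n → Fin n → Bool) {u v} → R u v ≡ true →
                 (u , v) ∈ filterᵇ (λ p → R (proj₁ p) (proj₂ p)) (pairs n)
∈-filter-pairs R Ruv =
  ∈-filter⁺ (T? ∘ _) (∈-cartesianProduct⁺ (∈-allFin _) (∈-allFin _)) (Equivalence.from T-≡ Ruv)

pairCount-pos : ∀ {n} (R : Fin n → Fin n → Bool) {u v} → R u v ≡ true → 0 < pairCount R
pairCount-pos R Ruv = ∈-length (∈-filter-pairs R Ruv)

∑₂-select : ∀ {n} (R : Fin n → Fin n → Bool) (g : Fin n → Fin n → ℤ) {u v} →
            pairCount R ≡ 1 → R u v ≡ true → ∑₂ (λ u v → 𝟙 (R u v) * g u v) ≡ g u v
∑₂-select {n} R g {u} {v} count Ruv = begin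
  ∑₂ (λ u v → 𝟙 (R u v) * g u v)         ≡⟨ sumˡ-pairs (λ p → 𝟙 (R′ p) * g′ p) ⟨
  sumˡ (pairs n) (λ p → 𝟙 (R′ p) * g′ p) ≡⟨ sumˡ-filterᵇ R′ (pairs n) g′ ⟨
  sumˡ (filterᵇ R′ (pairs n)) g′         ≡⟨ sumˡ-singleton _ g′ count (∈-filter-pairs R Ruv) ⟩
  g u v                                  ∎
  where
  open ≡-Reasoning
  R′ : Fin n × Fin n → Bool
  R′ (x , y) = R x y
  g′ : Fin n × Fin n → ℤ
  g′ (x , y) = g x y

isPair-sound : ∀ {n} {a b u v : Fin n} → isPair a b u v ≡ true → (a ≡ u × b ≡ v) ⊎ (a ≡ v × b ≡ u)
isPair-sound {a = a} {b} {u} {v} e with a ≟ u | b ≟ v | a ≟ v | b ≟ u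
... | yes a≡u | yes b≡v | _       | _       = inj₁ (a≡u , b≡v)
... | _       | _       | yes a≡v | yes b≡u = inj₂ (a≡v , b≡u)
... | no _    | _       | no _    | _       = ⊥-elim (false≢true e)
... | no _    | _       | yes _   | no _    = ⊥-elim (false≢true e)
... | yes _   | no _    | no _    | _       = ⊥-elim (false≢true e)
... | yes _   | no _    | yes _   | no _    = ⊥-elim (false≢true e)

isPair-elim : ∀ {n} (P : Fin n → Fin n → Set) {a b u v} → isPair a b u v ≡ true → P a b → P b a → P u v
isPair-elim P {a} {b} {u} {v} e Pab Pba with isPair-sound {a = a} {b} {u} {v} e
... | inj₁ (refl , refl) = Pab
... | inj₂ (refl , refl) = Pba

isPair-not-both : ∀ {n} (Q : Fin n → Set) {a b u v} → isPair a b u v ≡ true →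
                  (Q a → Q b → ⊥) → Q u → Q v → ⊥
isPair-not-both Q e ¬Qab = isPair-elim (λ x y → Q x → Q y → ⊥) e ¬Qab (flip ¬Qab)

isPair-sym : ∀ {n} (a b u v : Fin n) → isPair a b u v ≡ isPair a b v u
isPair-sym a b u v = ∨-comm (⌊ a ≟ u ⌋ ∧ ⌊ b ≟ v ⌋) (⌊ a ≟ v ⌋ ∧ ⌊ b ≟ u ⌋)

isPair-δ : ∀ {n} (p q u v : Fin n) → isPair p q u v ≡ (δ p u ∧ δ q v) ∨ (δ p v ∧ δ q u)
isPair-δ p q u v
  rewrite isYes≗does (p ≟ u) | isYes≗does (q ≟ v) | isYes≗does (p ≟ v) | isYes≗does (q ≟ u) = refl

∑₂-isPair : ∀ {n} {p q : Fin n} → p ≢ q → (f : Fin n → Fin n → ℤ) →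
            ∑₂ (λ u v → f u v * 𝟙 (isPair p q u v)) ≡ f p q + f q p
∑₂-isPair {n} {p} {q} p≢q f = begin
  ∑₂ (λ u v → f u v * 𝟙 (isPair p q u v))
    ≡⟨ ∑₂-cong pointwise ⟩
  ∑₂ (λ u v → 𝟙 (δ p u) * (𝟙 (δ q v) * f u v) + 𝟙 (δ q u) * (𝟙 (δ p v) * f u v))
    ≡⟨ ∑₂-distrib-+ {n} _ _ ⟩
  ∑₂ (λ u v → 𝟙 (δ p u) * (𝟙 (δ q v) * f u v)) + ∑₂ (λ u v → 𝟙 (δ q u) * (𝟙 (δ p v) * f u v))
    ≡⟨ cong₂ _+_ (∑₂-δ p q f) (∑₂-δ q p f) ⟩
  f p q + f q p
    ∎
  where
  open ≡-Reasoning
  disjoint : ∀ u → δ p u ∧ δ q u ≡ false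
  disjoint u with p ≟ u | q ≟ u
  ... | yes refl | yes refl = ⊥-elim (p≢q refl)
  ... | yes _    | no _     = refl
  ... | no _     | _        = refl
  indicator : ∀ a b c d → a ∧ d ≡ false →
              ∀ x → x * 𝟙 ((a ∧ b) ∨ (c ∧ d)) ≡ 𝟙 a * (𝟙 b * x) + 𝟙 d * (𝟙 c * x)
  indicator true  true  true  false _ = solve-∀
  indicator true  true  false false _ = solve-∀
  indicator true  false true  false _ = solve-∀
  indicator true  false false false _ = solve-∀
  indicator false true  true  true  _ = solve-∀
  indicator false true  true  false _ = solve-∀
  indicator false true  false true  _ = solve-∀
  indicator false true  false false _ = solve-∀
  indicator false false true  true  _ = solve-∀
  indicator false false true  false _ = solve-∀
  indicator false false false true  _ = solve-∀
  indicator false false false false _ = solve-∀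
  pointwise : ∀ u v → f u v * 𝟙 (isPair p q u v) ≡
                      𝟙 (δ p u) * (𝟙 (δ q v) * f u v) + 𝟙 (δ q u) * (𝟙 (δ p v) * f u v)
  pointwise u v rewrite isPair-δ p q u v = indicator (δ p u) (δ q v) (δ p v) (δ q u) (disjoint u) (f u v)

-- Signed degree sums

Symmetric : ∀ {n} → Adj n → Set
Symmetric F = ∀ u v → F u v ≡ F v u

Proper : ∀ {n} → Adj n → (Fin n → Bool) → Set
Proper F κ = ∀ u v → F u v ≡ true → κ u ≢ κ v

delete2-⊆ : ∀ {n} {A : Adj n} {a b c d} u v → delete2 A a b c d u v ≡ true → A u v ≡ true
delete2-⊆ {A = A} u v = ∧-conicalˡ (A u v) _

delete2-symmetric : ∀ {n} {A : Adj n} {a b c d} → Symmetric A → Symmetric (delete2 A a b c d)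
delete2-symmetric {a = a} {b} {c} {d} A-sym u v
  rewrite A-sym u v | isPair-sym a b u v | isPair-sym c d u v = refl

delete2-union : ∀ {n} {A : Adj n} {a b c d} → Symmetric A → A a b ≡ true → A c d ≡ true →
                ∀ u v → A u v ≡ delete2 A a b c d u v ∨ isPair a b u v ∨ isPair c d u v
delete2-union {A = A} A-sym Aab Acd u v = restore (pair⊆A Aab) (pair⊆A Acd)
  where
  pair⊆A : ∀ {p q} → A p q ≡ true → isPair p q u v ≡ true → A u v ≡ true
  pair⊆A {p} {q} Apq e = isPair-elim (λ x y → A x y ≡ true) e Apq (trans (A-sym q p) Apq)
  restore : ∀ {α x y} → (x ≡ true → α ≡ true) → (y ≡ true → α ≡ true) →
            α ≡ (α ∧ not (x ∨ y)) ∨ x ∨ y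
  restore {true}  {true}  {y}     _   _   = refl
  restore {true}  {false} {true}  _   _   = refl
  restore {true}  {false} {false} _   _   = refl
  restore {false} {true}  {y}     x⇒α _   = x⇒α refl
  restore {false} {false} {true}  _   y⇒α = y⇒α refl
  restore {false} {false} {false} _   _   = refl

perfectMatching-⊆ : ∀ {n} {H A M : Adj n} → (∀ u v → H u v ≡ true → A u v ≡ true) →
                    PerfectMatching H M → PerfectMatching A M
perfectMatching-⊆ H⊆A M-perfect = record { sub = λ u v → H⊆A u v ∘ sub u v ; symm = symm ; exact1 = exact1 }
  where open PerfectMatching M-perfect

weight : ∀ {n} → VSet n → (Fin n → ℤ) → ℤ
weight S w = sum (λ u → 𝟙 (S u) * w u)

degreeSum inner outer : ∀ {n} → VSet n → Adj n → (Fin n → ℤ) → ℤ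
degreeSum S F w = ∑₂ (λ u v → 𝟙 (S u) * w u * 𝟙 (F u v))
inner     S F w = ∑₂ (λ u v → 𝟙 (S u ∧ S v ∧ F u v) * w u)
outer     S F w = ∑₂ (λ u v → 𝟙 (S u ∧ not (S v) ∧ F u v) * w u)

degreeSum-split : ∀ {n} (S : VSet n) F w → degreeSum S F w ≡ inner S F w + outer S F w
degreeSum-split {n} S F w =
  trans (∑₂-cong (λ u v → split (S u) (S v) (F u v) (w u))) (∑₂-distrib-+ {n} _ _)
  where
  split : ∀ s t f (x : ℤ) → 𝟙 s * x * 𝟙 f ≡ 𝟙 (s ∧ t ∧ f) * x + 𝟙 (s ∧ not t ∧ f) * x
  split true  true  true  = solve-∀
  split true  true  false = solve-∀
  split true  false true  = solve-∀
  split true  false false = solve-∀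
  split false t     f     = solve-∀

degreeSum-regular : ∀ {n} (S : VSet n) F w {d} → (∀ u → degree F u ≡ d) →
                    degreeSum S F w ≡ + d * weight S w
degreeSum-regular {n} S F w {d} regular = begin
  ∑₂ (λ u v → 𝟙 (S u) * w u * 𝟙 (F u v))
    ≡⟨ sum-cong-≗ {n} (λ u → *-distribˡ-sum (𝟙 (S u) * w u) (λ v → 𝟙 (F u v))) ⟨
  sum (λ u → 𝟙 (S u) * w u * sum (λ v → 𝟙 (F u v)))
    ≡⟨ sum-cong-≗ {n} (λ u → cong (𝟙 (S u) * w u *_) degree≡d) ⟩
  sum (λ u → 𝟙 (S u) * w u * + d)
    ≡⟨ sum-cong-≗ {n} (λ u → ℤP.*-comm (𝟙 (S u) * w u) (+ d)) ⟩
  sum (λ u → + d * (𝟙 (S u) * w u))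
    ≡⟨ *-distribˡ-sum (+ d) (λ u → 𝟙 (S u) * w u) ⟨
  + d * weight S w
    ∎
  where
  open ≡-Reasoning
  degree≡d : ∀ {u} → sum (λ v → 𝟙 (F u v)) ≡ + d
  degree≡d {u} = trans (sym (length-filterᵇ-allFin (F u))) (cong +_ (regular u))

inner-zero : ∀ {n} (S : VSet n) F w → Symmetric F →
             (∀ u v → S u ≡ true → S v ≡ true → F u v ≡ true → w u + w v ≡ + 0) → inner S F w ≡ + 0
inner-zero {n} S F w F-sym cancel = x+x≡0⇒x≡0 (begin
  inner S F w + inner S F w
    ≡⟨ cong (_+_ (inner S F w)) (trans (∑-comm {n} {n} _) (∑₂-cong transpose)) ⟩
  inner S F w + ∑₂ (λ u v → 𝟙 (S u ∧ S v ∧ F u v) * w v)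
    ≡⟨ ∑₂-distrib-+ {n} _ _ ⟨
  ∑₂ (λ u v → 𝟙 (S u ∧ S v ∧ F u v) * w u + 𝟙 (S u ∧ S v ∧ F u v) * w v)
    ≡⟨ ∑₂-cong pointwise ⟩
  ∑₂ {n} (λ _ _ → + 0)
    ≡⟨ ∑₂-zero n ⟩
  + 0
    ∎)
  where
  open ≡-Reasoning
  transpose : ∀ u v → 𝟙 (S v ∧ S u ∧ F v u) * w v ≡ 𝟙 (S u ∧ S v ∧ F u v) * w v
  transpose u v rewrite F-sym v u with S u | S v
  ... | true  | true  = refl
  ... | true  | false = refl
  ... | false | true  = refl
  ... | false | false = refl
  pointwise : ∀ u v → 𝟙 (S u ∧ S v ∧ F u v) * w u + 𝟙 (S u ∧ S v ∧ F u v) * w v ≡ + 0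
  pointwise u v with S u ∧ S v ∧ F u v in e
  ... | false = refl
  ... | true  = let (Su , SvFuv) = ∧-true e ; (Sv , Fuv) = ∧-true SvFuv in
    trans (cong₂ _+_ (ℤP.*-identityˡ (w u)) (ℤP.*-identityˡ (w v))) (cancel u v Su Sv Fuv)

outer-unit : ∀ {n} (S : VSet n) F w → (∀ u v → S u ≡ true → S v ≡ false → F u v ≡ true → w u ≡ + 1) →
             outer S F w ≡ + cutCount S F
outer-unit S F w unit = trans (∑₂-cong pointwise) (sym (pairCount-∑₂ (λ u v → S u ∧ not (S v) ∧ F u v)))
  where
  pointwise : ∀ u v → 𝟙 (S u ∧ not (S v) ∧ F u v) * w u ≡ 𝟙 (S u ∧ not (S v) ∧ F u v)
  pointwise u v with S u ∧ not (S v) ∧ F u v in e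
  ... | false = refl
  ... | true  = let (Su , ¬SvFuv) = ∧-true e ; (¬Sv , Fuv) = ∧-true ¬SvFuv in
    trans (ℤP.*-identityˡ (w u)) (unit u v Su (not-true ¬Sv) Fuv)

outer-tight : ∀ {n} (S : VSet n) F w {u v} → cutCount S F ≡ 1 →
              S u ≡ true → S v ≡ false → F u v ≡ true → outer S F w ≡ w u
outer-tight S F w {u} {v} tight Su Sv Fuv =
  ∑₂-select (λ u v → S u ∧ not (S v) ∧ F u v) (λ u _ → w u) tight crossing
  where
  crossing : S u ∧ not (S v) ∧ F u v ≡ true
  crossing rewrite Su | Sv | Fuv = refl

cutCount-complement : ∀ {n} (S : VSet n) F → Symmetric F → cutCount (complement S) F ≡ cutCount S F
cutCount-complement {n} S F F-sym = ℤP.+-injective (begin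
  + cutCount (complement S) F
    ≡⟨ pairCount-∑₂ (λ u v → not (S u) ∧ not (not (S v)) ∧ F u v) ⟩
  ∑₂ (λ u v → 𝟙 (not (S u) ∧ not (not (S v)) ∧ F u v))
    ≡⟨ ∑-comm {n} {n} _ ⟩
  ∑₂ (λ u v → 𝟙 (not (S v) ∧ not (not (S u)) ∧ F v u))
    ≡⟨ ∑₂-cong pointwise ⟩
  ∑₂ (λ u v → 𝟙 (S u ∧ not (S v) ∧ F u v))
    ≡⟨ pairCount-∑₂ (λ u v → S u ∧ not (S v) ∧ F u v) ⟨
  + cutCount S F
    ∎)
  where
  open ≡-Reasoning
  pointwise : ∀ u v → 𝟙 (not (S v) ∧ not (not (S u)) ∧ F v u) ≡ 𝟙 (S u ∧ not (S v) ∧ F u v)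
  pointwise u v rewrite F-sym v u with S u | S v
  ... | true  | true  = refl
  ... | true  | false = refl
  ... | false | true  = refl
  ... | false | false = refl

tight-complement : ∀ {n} {A : Adj n} {X : VSet n} → Tight A (complement X) → Tight A X
tight-complement {X = X} tight M M-perfect =
  trans (sym (cutCount-complement X M (PerfectMatching.symm M-perfect))) (tight M M-perfect)

handshake : ∀ {n} (S : VSet n) F {d} → (∀ u → degree F u ≡ d) →
            d ℕ.* size S ≡ innerCount S F ℕ.+ cutCount S F
handshake {n} S F {d} regular = ℤP.+-injective (begin
  + (d ℕ.* size S)                     ≡⟨ ℤP.pos-* d (size S) ⟩
  + d * + size S                       ≡⟨ cong (+ d *_) size≡weight ⟩
  + d * weight S one                   ≡⟨ degreeSum-regular S F one regular ⟨
  degreeSum S F one                    ≡⟨ degreeSum-split S F one ⟩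
  inner S F one + outer S F one        ≡⟨ cong₂ _+_ inner≡innerCount (outer-unit S F one (λ _ _ _ _ _ → refl)) ⟩
  + innerCount S F + + cutCount S F    ≡⟨ ℤP.pos-+ (innerCount S F) (cutCount S F) ⟨
  + (innerCount S F ℕ.+ cutCount S F)  ∎)
  where
  open ≡-Reasoning
  one : Fin n → ℤ
  one _ = + 1
  size≡weight : + size S ≡ weight S one
  size≡weight = trans (length-filterᵇ-allFin S) (sum-cong-≗ {n} (λ u → sym (ℤP.*-identityʳ (𝟙 (S u)))))
  inner≡innerCount : inner S F one ≡ + innerCount S F
  inner≡innerCount = trans (∑₂-cong (λ u v → ℤP.*-identityʳ (𝟙 (S u ∧ S v ∧ F u v))))
                           (sym (pairCount-∑₂ (λ u v → S u ∧ S v ∧ F u v)))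

degreeSum-sgn : ∀ {n} (S : VSet n) F (c : Fin n → Bool) → Symmetric F →
                (∀ u v → S u ≡ true → S v ≡ true → F u v ≡ true → c u ≢ c v) →
                (∀ u v → S u ≡ true → S v ≡ false → F u v ≡ true → c u ≡ true) →
                degreeSum S F (sgn ∘ c) ≡ + cutCount S F
degreeSum-sgn S F c F-sym inside leaving = begin
  degreeSum S F (sgn ∘ c)                   ≡⟨ degreeSum-split S F (sgn ∘ c) ⟩
  inner S F (sgn ∘ c) + outer S F (sgn ∘ c) ≡⟨ cong₂ _+_ inner≡0 outer≡cut ⟩
  + 0 + + cutCount S F                      ≡⟨ ℤP.+-identityˡ _ ⟩
  + cutCount S F                            ∎
  where
  open ≡-Reasoning
  inner≡0 : inner S F (sgn ∘ c) ≡ + 0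
  inner≡0 = inner-zero S F (sgn ∘ c) F-sym (λ u v Su Sv Fuv → sgn-cancel (inside u v Su Sv Fuv))
  outer≡cut : outer S F (sgn ∘ c) ≡ + cutCount S F
  outer≡cut = outer-unit S F (sgn ∘ c) (λ u v Su Sv Fuv → cong sgn (leaving u v Su Sv Fuv))

tight⇒weight≡sgn : ∀ {n} {A M : Adj n} {X : VSet n} (κ : Fin n → Bool) → Tight A X → PerfectMatching A M →
                   (∀ u v → M u v ≡ true → κ u ≢ κ v) →
                   ∀ {u v} → X u ≡ true → X v ≡ false → M u v ≡ true → weight X (sgn ∘ κ) ≡ sgn (κ u)
tight⇒weight≡sgn {M = M} {X} κ tight M-perfect separates {u} Xu Xv Muv = begin
  weight X (sgn ∘ κ)                        ≡⟨ ℤP.*-identityˡ _ ⟨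
  + 1 * weight X (sgn ∘ κ)                  ≡⟨ degreeSum-regular X M (sgn ∘ κ) exact1 ⟨
  degreeSum X M (sgn ∘ κ)                   ≡⟨ degreeSum-split X M (sgn ∘ κ) ⟩
  inner X M (sgn ∘ κ) + outer X M (sgn ∘ κ) ≡⟨ cong₂ _+_ inner≡0 outer≡sgn ⟩
  + 0 + sgn (κ u)                           ≡⟨ ℤP.+-identityˡ _ ⟩
  sgn (κ u)                                 ∎
  where
  open ≡-Reasoning
  open PerfectMatching M-perfect
  inner≡0 : inner X M (sgn ∘ κ) ≡ + 0
  inner≡0 = inner-zero X M (sgn ∘ κ) symm (λ u v _ _ Muv → sgn-cancel (separates u v Muv))
  outer≡sgn : outer X M (sgn ∘ κ) ≡ sgn (κ u)
  outer≡sgn = outer-tight X M (sgn ∘ κ) (tight M M-perfect) Xu Xv Muv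

-- Colour classes and perfect matchings

module _ {n} {A M₀ : Adj n} (T : VSet n) (M₀-perfect : PerfectMatching A M₀)
         (M₀-separates : ∀ u v → M₀ u v ≡ true → T u ≢ T v) where

  private
    size≡cutCount : ∀ (S : VSet n) → (∀ u v → S u ≡ true → S v ≡ true → M₀ u v ≡ true → ⊥) →
                    size S ≡ cutCount S M₀
    size≡cutCount S none = begin
      size S                             ≡⟨ ℕP.*-identityˡ (size S) ⟨
      1 ℕ.* size S                       ≡⟨ handshake S M₀ (PerfectMatching.exact1 M₀-perfect) ⟩
      innerCount S M₀ ℕ.+ cutCount S M₀  ≡⟨ cong (ℕ._+ cutCount S M₀) (pairCount-zero _ inside) ⟩
      cutCount S M₀                      ∎
      where
      open ≡-Reasoning
      inside : ∀ u v → S u ∧ S v ∧ M₀ u v ≡ true → ⊥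
      inside u v e = let (Su , e′) = ∧-true e ; (Sv , M₀uv) = ∧-true e′ in none u v Su Sv M₀uv

  colour-classes-balanced : size T ≡ size (complement T)
  colour-classes-balanced = begin
    size T
      ≡⟨ size≡cutCount T (λ u v Tu Tv M₀uv → M₀-separates u v M₀uv (trans Tu (sym Tv))) ⟩
    cutCount T M₀
      ≡⟨ cutCount-complement T M₀ (PerfectMatching.symm M₀-perfect) ⟨
    cutCount (complement T) M₀
      ≡⟨ size≡cutCount (complement T)
           (λ u v Tu Tv M₀uv → M₀-separates u v M₀uv (not-injective (trans Tu (sym Tv)))) ⟨
    size (complement T)
      ∎
    where open ≡-Reasoning

  innerCount-balanced : ∀ {M} → PerfectMatching A M → innerCount T M ≡ innerCount (complement T) M
  innerCount-balanced {M} M-perfect = ℕP.+-cancelʳ-≡ (cutCount T M) _ _ (begin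
    innerCount T M ℕ.+ cutCount T M
      ≡⟨ handshake T M exact1 ⟨
    1 ℕ.* size T
      ≡⟨ cong (1 ℕ.*_) colour-classes-balanced ⟩
    1 ℕ.* size (complement T)
      ≡⟨ handshake (complement T) M exact1 ⟩
    innerCount (complement T) M ℕ.+ cutCount (complement T) M
      ≡⟨ cong (innerCount (complement T) M ℕ.+_) (cutCount-complement T M symm) ⟩
    innerCount (complement T) M ℕ.+ cutCount T M
      ∎)
    where
    open ≡-Reasoning
    open PerfectMatching M-perfect

  complement-innerCount-pos : ∀ {M p q} → PerfectMatching A M → M p q ≡ true → T p ≡ true → T q ≡ true →
                              0 < innerCount (complement T) M
  complement-innerCount-pos {M} {p} {q} M-perfect Mpq Tp Tq =
    subst (0 <_) (innerCount-balanced M-perfect) (pairCount-pos (λ u v → T u ∧ T v ∧ M u v) pq-inside)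
    where
    pq-inside : T p ∧ T q ∧ M p q ≡ true
    pq-inside rewrite Tp | Tq | Mpq = refl

  opposite-monochromatic-edge :
    (∀ u v → A u v ≡ true → Σ (Adj n) λ M → PerfectMatching A M × M u v ≡ true) →
    ∀ {p q} → A p q ≡ true → T p ≡ true → T q ≡ true →
    ∃₂ λ u v → T u ≡ false × T v ≡ false × A u v ≡ true
  opposite-monochromatic-edge covered {p} {q} Apq Tp Tq with covered p q Apq
  ... | M , M-perfect , Mpq
    with pairCount-witness (λ u v → not (T u) ∧ not (T v) ∧ M u v)
                           (complement-innerCount-pos M-perfect Mpq Tp Tq)
  ... | u , v , e = let (Tu , e′) = ∧-true e ; (Tv , Muv) = ∧-true e′ in
                    u , v , not-true Tu , not-true Tv , PerfectMatching.sub M-perfect u v Muv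

reach-edge : ∀ {n} {F : Adj n} {u w} → Reach F u w → u ≢ w → ∃₂ λ x y → F x y ≡ true
reach-edge here                 u≢w = ⊥-elim (u≢w refl)
reach-edge (step {v} {w} _ Fvw) _   = v , w , Fvw

size-witness : ∀ {n} (S : VSet n) → 2 ℕ.≤ size S → Σ (Fin n) λ u → S u ≡ true
size-witness {n} S S≥2 = filterᵇ-witness S (allFin n) (ℕP.≤-trans (s≤s ℕ.z≤n) S≥2)

-- Contractions

-- κ colours the vertices outside Y and β the vertex that Y is contracted to.
record ContractionColouring {n} (A : Adj n) (Y : VSet n) (κ : Fin n → Bool) (β : Bool) : Set where
  field
    outside : ∀ u v → Y u ≡ false → Y v ≡ false → A u v ≡ true → κ u ≢ κ v
    across  : ∀ u v → Y u ≡ false → Y v ≡ true → A u v ≡ true → κ u ≢ β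

colourAt : ∀ {n} {Y : VSet n} → (ContrV Y → Bool) → (u : Fin n) (b : Bool) → Y u ≡ b → Bool
colourAt c u true  _  = c nothing
colourAt c u false Yu = c (just (u , Yu))

colourAt-just : ∀ {n} {Y : VSet n} (c : ContrV Y → Bool) u b (Yu≡b : Y u ≡ b) (Yu : Y u ≡ false) →
                colourAt c u b Yu≡b ≡ c (just (u , Yu))
colourAt-just c u false Yu≡b Yu = cong (λ p → c (just (u , p))) (Bool-UIP Yu≡b Yu)
colourAt-just c u true  Yu≡b Yu = ⊥-elim (true≢false (trans (sym Yu≡b) Yu))

liftColour : ∀ {n} {Y : VSet n} → (ContrV Y → Bool) → Fin n → Bool
liftColour {Y = Y} c u = colourAt c u (Y u) refl

liftColour-just : ∀ {n} {Y : VSet n} (c : ContrV Y → Bool) u (Yu : Y u ≡ false) →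
                  liftColour c u ≡ c (just (u , Yu))
liftColour-just {Y = Y} c u = colourAt-just c u (Y u) refl

bipartite⇒contractionColouring : ∀ {n} (A : Adj n) (Y : VSet n) → BipartiteRel (contractAdj A Y) →
                                 ∃₂ (ContractionColouring A Y)
bipartite⇒contractionColouring A Y (c , proper) = liftColour c , c nothing , record
  { outside = λ u v Yu Yv Auv → subst₂ _≢_ (sym (liftColour-just c u Yu)) (sym (liftColour-just c v Yv))
                                        (proper (just (u , Yu)) (just (v , Yv)) Auv)
  ; across  = λ u v Yu Yv Auv → subst (_≢ c nothing) (sym (liftColour-just c u Yu))
                                       (proper (just (u , Yu)) nothing (v , Yv , Auv))
  }

contractionColouring⇒bipartite : ∀ {n} {A : Adj n} {Y : VSet n} {κ β} → Symmetric A →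
                                 ContractionColouring A Y κ β → BipartiteRel (contractAdj A Y)
contractionColouring⇒bipartite {A = A} {Y} {κ} {β} A-sym colouring = colour , proper
  where
  open ContractionColouring colouring
  colour : ContrV Y → Bool
  colour nothing        = β
  colour (just (u , _)) = κ u
  proper : ∀ x y → contractAdj A Y x y → colour x ≢ colour y
  proper nothing         (just (v , Yv)) (u , Yu , Auv) = across v u Yv Yu (trans (A-sym v u) Auv) ∘ sym
  proper (just (u , Yu)) nothing         (v , Yv , Auv) = across u v Yu Yv Auv
  proper (just (u , Yu)) (just (v , Yv)) Auv            = outside u v Yu Yv Auv

contractionColouring⇒tight : ∀ {n} {A : Adj n} {Y : VSet n} {κ β} → IsSimple A → Cubic A →
                             cutCount Y A ≡ 3 → ContractionColouring A Y κ β → Tight A Y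
contractionColouring⇒tight {n} {A} {Y} {κ} {β} simple cubic cut≡3 colouring M M-perfect =
  ℤP.+-injective (begin
    + cutCount Y M                ≡⟨ signed-cut M PM.sub PM.symm PM.exact1 ⟨
    + 1 * weight (complement Y) s ≡⟨ cong (+ 1 *_) weight≡1 ⟩
    + 1                           ∎)
  where
  open ≡-Reasoning
  open ContractionColouring colouring
  module PM = PerfectMatching M-perfect
  c : Fin n → Bool
  c u = β xor κ u
  s : Fin n → ℤ
  s = sgn ∘ c
  signed-cut : ∀ F → (∀ u v → F u v ≡ true → A u v ≡ true) → Symmetric F →
               ∀ {d} → (∀ u → degree F u ≡ d) → + d * weight (complement Y) s ≡ + cutCount Y F
  signed-cut F F⊆A F-sym {d} regular = begin
    + d * weight (complement Y) s ≡⟨ degreeSum-regular (complement Y) F s regular ⟨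
    degreeSum (complement Y) F s  ≡⟨ degreeSum-sgn (complement Y) F c F-sym inside leaving ⟩
    + cutCount (complement Y) F   ≡⟨ cong +_ (cutCount-complement Y F F-sym) ⟩
    + cutCount Y F                ∎
    where
    inside : ∀ u v → not (Y u) ≡ true → not (Y v) ≡ true → F u v ≡ true → c u ≢ c v
    inside u v Yu Yv Fuv = xorˡ-≢ β (outside u v (not-true Yu) (not-true Yv) (F⊆A u v Fuv))
    leaving : ∀ u v → not (Y u) ≡ true → not (Y v) ≡ false → F u v ≡ true → c u ≡ true
    leaving u v Yu Yv Fuv = ≢⇒xor (across u v (not-true Yu) (not-false Yv) (F⊆A u v Fuv) ∘ sym)
  weight≡1 : weight (complement Y) s ≡ + 1
  weight≡1 = ℤP.*-cancelˡ-≡ (+ 3) _ (+ 1)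
               (trans (signed-cut A (λ _ _ Auv → Auv) (IsSimple.symm simple) cubic) (cong +_ cut≡3))

bipartite-contraction⇒tight : ∀ {n} {A : Adj n} {Y : VSet n} → IsSimple A → Cubic A →
                              cutCount Y A ≡ 3 → BipartiteRel (contractAdj A Y) → Tight A Y
bipartite-contraction⇒tight {A = A} {Y} simple cubic cut≡3 G/Y-bipartite =
  let (_ , _ , colouring) = bipartite⇒contractionColouring A Y G/Y-bipartite
  in contractionColouring⇒tight simple cubic cut≡3 colouring

-- The two removed edges

-- Left: the ends of pq (sign +1) and of rt (sign -1) lying in X; right: the crossings of pq and rt.
ends≡leaving⇒ : ∀ xp xq xr xt →
  𝟙 xp * + 1 + 𝟙 xq * + 1 + (𝟙 xr * -[1+ 0 ] + 𝟙 xt * -[1+ 0 ]) ≡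
  𝟙 (xp ∧ not xq) + 𝟙 (xq ∧ not xp) + (𝟙 (xr ∧ not xt) + 𝟙 (xt ∧ not xr)) →
  xp ∧ xq ≡ xr ∨ xt
ends≡leaving⇒ true  true  true  true  _ = refl
ends≡leaving⇒ true  true  true  false _ = refl
ends≡leaving⇒ true  true  false true  _ = refl
ends≡leaving⇒ true  true  false false ()
ends≡leaving⇒ true  false true  true  ()
ends≡leaving⇒ true  false true  false ()
ends≡leaving⇒ true  false false true  ()
ends≡leaving⇒ true  false false false _ = refl
ends≡leaving⇒ false true  true  true  ()
ends≡leaving⇒ false true  true  false ()
ends≡leaving⇒ false true  false true  ()
ends≡leaving⇒ false true  false false _ = refl
ends≡leaving⇒ false false true  true  ()
ends≡leaving⇒ false false true  false ()
ends≡leaving⇒ false false false true  ()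
ends≡leaving⇒ false false false false _ = refl

module RemovedEdges {n} {A H : Adj n} {X : VSet n} {κ : Fin n → Bool} {p q r t : Fin n}
  (A-sym : Symmetric A) (cubic : Cubic A) (cut≡3 : cutCount X A ≡ 3)
  (A-union : ∀ u v → A u v ≡ H u v ∨ isPair p q u v ∨ isPair r t u v)
  (p≢q : p ≢ q) (r≢t : r ≢ t) (H-sym : Symmetric H) (κ-proper : Proper H κ)
  (κp : κ p ≡ true) (κq : κ q ≡ true) (κr : κ r ≡ false) (κt : κ t ≡ false)
  (leaving : ∀ u v → X u ≡ true → X v ≡ false → H u v ≡ true → κ u ≡ true)
  (weight≡1 : weight X (sgn ∘ κ) ≡ + 1)
  where

  pq-colours : ∀ {u v} → isPair p q u v ≡ true → κ u ≡ true × κ v ≡ true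
  pq-colours e = isPair-elim (λ x y → κ x ≡ true × κ y ≡ true) e (κp , κq) (κq , κp)

  rt-colours : ∀ {u v} → isPair r t u v ≡ true → κ u ≡ false × κ v ≡ false
  rt-colours e = isPair-elim (λ x y → κ x ≡ false × κ y ≡ false) e (κr , κt) (κt , κr)

  A-edge-cases : ∀ {u v} → A u v ≡ true → H u v ≡ true ⊎ isPair p q u v ≡ true ⊎ isPair r t u v ≡ true
  A-edge-cases {u} {v} Auv = ∨₃-true (trans (sym (A-union u v)) Auv)

  𝟙-A : ∀ u v → 𝟙 (A u v) ≡ 𝟙 (H u v) + 𝟙 (isPair p q u v) + 𝟙 (isPair r t u v)
  𝟙-A u v = trans (cong 𝟙 (A-union u v))
                  (𝟙-∨₃ {H u v} {isPair p q u v} {isPair r t u v}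
                        (∧-false H∩pq) (∧-false H∩rt) (∧-false pq∩rt))
    where
    H∩pq : H u v ≡ true → isPair p q u v ≡ true → ⊥
    H∩pq Huv e = κ-proper u v Huv (trans (proj₁ (pq-colours e)) (sym (proj₂ (pq-colours e))))
    H∩rt : H u v ≡ true → isPair r t u v ≡ true → ⊥
    H∩rt Huv e = κ-proper u v Huv (trans (proj₁ (rt-colours e)) (sym (proj₂ (rt-colours e))))
    pq∩rt : isPair p q u v ≡ true → isPair r t u v ≡ true → ⊥
    pq∩rt e e′ = true≢false (trans (sym (proj₁ (pq-colours e))) (proj₁ (rt-colours e′)))

  ∑₂-A : ∀ f → ∑₂ (λ u v → f u v * 𝟙 (A u v)) ≡
               ∑₂ (λ u v → f u v * 𝟙 (H u v)) + (f p q + f q p) + (f r t + f t r)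
  ∑₂-A f = begin
    ∑₂ (λ u v → f u v * 𝟙 (A u v))
      ≡⟨ ∑₂-cong (λ u v → trans (cong (f u v *_) (𝟙-A u v)) (distrib (f u v) _ _ _)) ⟩
    ∑₂ (λ u v → f u v * 𝟙 (H u v) + f u v * 𝟙 (isPair p q u v) + f u v * 𝟙 (isPair r t u v))
      ≡⟨ trans (∑₂-distrib-+ {n} _ _) (cong (_+ _) (∑₂-distrib-+ {n} _ _)) ⟩
    ∑₂ (λ u v → f u v * 𝟙 (H u v)) + ∑₂ (λ u v → f u v * 𝟙 (isPair p q u v))
                                   + ∑₂ (λ u v → f u v * 𝟙 (isPair r t u v))
      ≡⟨ cong₂ (λ x y → ∑₂ (λ u v → f u v * 𝟙 (H u v)) + x + y)
               (∑₂-isPair p≢q f) (∑₂-isPair r≢t f) ⟩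
    ∑₂ (λ u v → f u v * 𝟙 (H u v)) + (f p q + f q p) + (f r t + f t r)
      ∎
    where
    open ≡-Reasoning
    distrib : ∀ x a b c → x * (a + b + c) ≡ x * a + x * b + x * c
    distrib = solve-∀

  s : Fin n → ℤ
  s = sgn ∘ κ

  ends-pq ends-rt leaving-pq leaving-rt : ℤ
  ends-pq    = 𝟙 (X p) * s p + 𝟙 (X q) * s q
  ends-rt    = 𝟙 (X r) * s r + 𝟙 (X t) * s t
  leaving-pq = 𝟙 (X p ∧ not (X q)) + 𝟙 (X q ∧ not (X p))
  leaving-rt = 𝟙 (X r ∧ not (X t)) + 𝟙 (X t ∧ not (X r))

  degree-count : + 3 ≡ + cutCount X H + ends-pq + ends-rt
  degree-count = begin
    + 3                                 ≡⟨ cong (+ 3 *_) weight≡1 ⟨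
    + 3 * weight X s                    ≡⟨ degreeSum-regular X A s cubic ⟨
    degreeSum X A s                     ≡⟨ ∑₂-A (λ u _ → 𝟙 (X u) * s u) ⟩
    degreeSum X H s + ends-pq + ends-rt ≡⟨ cong (λ x → x + ends-pq + ends-rt) H-degreeSum ⟩
    + cutCount X H + ends-pq + ends-rt  ∎
    where
    open ≡-Reasoning
    H-degreeSum : degreeSum X H s ≡ + cutCount X H
    H-degreeSum = degreeSum-sgn X H κ H-sym (λ u v _ _ → κ-proper u v) leaving

  cut-count : + 3 ≡ + cutCount X H + leaving-pq + leaving-rt
  cut-count = begin
    + 3
      ≡⟨ cong +_ cut≡3 ⟨
    + cutCount X A
      ≡⟨ cutCount-∑₂ X A ⟩
    ∑₂ (λ u v → 𝟙 (X u ∧ not (X v)) * 𝟙 (A u v))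
      ≡⟨ ∑₂-A (λ u v → 𝟙 (X u ∧ not (X v))) ⟩
    ∑₂ (λ u v → 𝟙 (X u ∧ not (X v)) * 𝟙 (H u v)) + leaving-pq + leaving-rt
      ≡⟨ cong (λ x → x + leaving-pq + leaving-rt) (cutCount-∑₂ X H) ⟨
    + cutCount X H + leaving-pq + leaving-rt
      ∎
    where open ≡-Reasoning

  pq⊆X⇔rt-meets-X : X p ∧ X q ≡ X r ∨ X t
  pq⊆X⇔rt-meets-X = ends≡leaving⇒ (X p) (X q) (X r) (X t) (trans (sym signs) ends≡leaving)
    where
    signs : ends-pq + ends-rt ≡ 𝟙 (X p) * + 1 + 𝟙 (X q) * + 1 + (𝟙 (X r) * -[1+ 0 ] + 𝟙 (X t) * -[1+ 0 ])
    signs rewrite κp | κq | κr | κt = refl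
    ends≡leaving : ends-pq + ends-rt ≡ leaving-pq + leaving-rt
    ends≡leaving = ∙-cancelˡ (+ cutCount X H) (ends-pq + ends-rt) (leaving-pq + leaving-rt) (begin
      + cutCount X H + (ends-pq + ends-rt)       ≡⟨ ℤP.+-assoc (+ cutCount X H) ends-pq ends-rt ⟨
      + cutCount X H + ends-pq + ends-rt         ≡⟨ trans (sym degree-count) cut-count ⟩
      + cutCount X H + leaving-pq + leaving-rt   ≡⟨ ℤP.+-assoc (+ cutCount X H) leaving-pq leaving-rt ⟩
      + cutCount X H + (leaving-pq + leaving-rt) ∎)
      where open ≡-Reasoning

  colouring-X : X p ∧ X q ≡ true → ContractionColouring A X κ true
  colouring-X pq⊆X = record { outside = outside ; across = across }
    where
    pq-inside : ∀ {u v} → isPair p q u v ≡ true → X u ≡ true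
    pq-inside e = isPair-elim (λ x _ → X x ≡ true) e (proj₁ (∧-true pq⊆X)) (proj₂ (∧-true pq⊆X))
    rt-meets-X : X r ≡ false → X t ≡ false → ⊥
    rt-meets-X Xr Xt = false≢true (trans (sym (cong₂ _∨_ Xr Xt)) (trans (sym pq⊆X⇔rt-meets-X) pq⊆X))
    outside : ∀ u v → X u ≡ false → X v ≡ false → A u v ≡ true → κ u ≢ κ v
    outside u v Xu Xv Auv with A-edge-cases Auv
    ... | inj₁ Huv      = κ-proper u v Huv
    ... | inj₂ (inj₁ e) = ⊥-elim (true≢false (trans (sym (pq-inside e)) Xu))
    ... | inj₂ (inj₂ e) = ⊥-elim (isPair-not-both (λ x → X x ≡ false) e rt-meets-X Xu Xv)
    across : ∀ u v → X u ≡ false → X v ≡ true → A u v ≡ true → κ u ≢ true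
    across u v Xu Xv Auv with A-edge-cases Auv
    ... | inj₁ Huv      = let Hvu = trans (H-sym v u) Huv in
                          λ κu → κ-proper v u Hvu (trans (leaving v u Xv Xu Hvu) (sym κu))
    ... | inj₂ (inj₁ e) = ⊥-elim (true≢false (trans (sym (pq-inside e)) Xu))
    ... | inj₂ (inj₂ e) = λ κu → true≢false (trans (sym κu) (proj₁ (rt-colours e)))

  colouring-X̄ : X p ∧ X q ≡ false → ContractionColouring A (complement X) κ false
  colouring-X̄ pq⊈X = record { outside = outside ; across = across }
    where
    pq-not-inside : X p ≡ true → X q ≡ true → ⊥
    pq-not-inside Xp Xq = true≢false (trans (sym (cong₂ _∧_ Xp Xq)) pq⊈X)
    rt∩X≡∅ : X r ∨ X t ≡ false
    rt∩X≡∅ = trans (sym pq⊆X⇔rt-meets-X) pq⊈X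
    rt-outside : ∀ {u v} → isPair r t u v ≡ true → X u ≡ false
    rt-outside e = isPair-elim (λ x _ → X x ≡ false) e (∨-conicalˡ _ _ rt∩X≡∅) (∨-conicalʳ _ _ rt∩X≡∅)
    outside : ∀ u v → not (X u) ≡ false → not (X v) ≡ false → A u v ≡ true → κ u ≢ κ v
    outside u v Xu Xv Auv with A-edge-cases Auv
    ... | inj₁ Huv      = κ-proper u v Huv
    ... | inj₂ (inj₁ e) =
      ⊥-elim (isPair-not-both (λ x → X x ≡ true) e pq-not-inside (not-false Xu) (not-false Xv))
    ... | inj₂ (inj₂ e) = ⊥-elim (true≢false (trans (sym (not-false Xu)) (rt-outside e)))
    across : ∀ u v → not (X u) ≡ false → not (X v) ≡ true → A u v ≡ true → κ u ≢ false
    across u v Xu Xv Auv with A-edge-cases Auv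
    ... | inj₁ Huv      = λ κu → true≢false (trans (sym (leaving u v (not-false Xu) (not-true Xv) Huv)) κu)
    ... | inj₂ (inj₁ e) = λ κu → true≢false (trans (sym (proj₁ (pq-colours e))) κu)
    ... | inj₂ (inj₂ e) = ⊥-elim (true≢false (trans (sym (not-false Xu)) (rt-outside e)))

  contraction-bipartite : BipartiteRel (contractAdj A X) ⊎ BipartiteRel (contractAdj A (complement X))
  contraction-bipartite with X p ∧ X q in pq⊆X
  ... | true  = inj₁ (contractionColouring⇒bipartite A-sym (colouring-X pq⊆X))
  ... | false = inj₂ (contractionColouring⇒bipartite A-sym (colouring-X̄ pq⊆X))

module TightCut {n} {A : Adj n} {X : VSet n} (simple : IsSimple A) (cubic : Cubic A)
  (cut≡3 : cutCount X A ≡ 3) (tight : Tight A X) (A-nonbipartite : ¬ Bipartite A)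
  (A-covered : ∀ u v → A u v ≡ true → Σ (Adj n) λ M → PerfectMatching A M × M u v ≡ true)
  {a b c d : Fin n} (Aab : A a b ≡ true) (Acd : A c d ≡ true)
  (κ₀ : Fin n → Bool) (κ₀-proper : Proper (delete2 A a b c d) κ₀)
  (H-covered : ∀ u v → delete2 A a b c d u v ≡ true →
               Σ (Adj n) λ M → PerfectMatching (delete2 A a b c d) M × M u v ≡ true)
  {M₀ : Adj n} (M₀-perfect : PerfectMatching (delete2 A a b c d) M₀)
  {u₀ v₀ : Fin n} (Xu₀ : X u₀ ≡ true) (Xv₀ : X v₀ ≡ false) (M₀u₀v₀ : M₀ u₀ v₀ ≡ true)
  where

  open IsSimple simple renaming (symm to A-sym)

  H : Adj n
  H = delete2 A a b c d

  H⊆A : ∀ u v → H u v ≡ true → A u v ≡ true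
  H⊆A = delete2-⊆ {a = a} {b} {c} {d}

  H-sym : Symmetric H
  H-sym = delete2-symmetric {a = a} {b} {c} {d} A-sym

  A-union : ∀ u v → A u v ≡ H u v ∨ isPair a b u v ∨ isPair c d u v
  A-union = delete2-union A-sym Aab Acd

  A-union′ : ∀ u v → A u v ≡ H u v ∨ isPair c d u v ∨ isPair a b u v
  A-union′ u v = trans (A-union u v) (cong (H u v ∨_) (∨-comm (isPair a b u v) (isPair c d u v)))

  edge-ends-≢ : ∀ {p q} → A p q ≡ true → p ≢ q
  edge-ends-≢ {p} Apq refl = true≢false (trans (sym Apq) (irrefl p))

  -- Recolour so that the matching edge u₀v₀ leaves X from the colour true.
  κ : Fin n → Bool
  κ u = not (κ₀ u₀) xor κ₀ u

  κ-proper : Proper H κ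
  κ-proper u v Huv = xorˡ-≢ (not (κ₀ u₀)) (κ₀-proper u v Huv)

  separates : ∀ {M} → PerfectMatching H M → ∀ u v → M u v ≡ true → κ u ≢ κ v
  separates M-perfect u v = κ-proper u v ∘ PerfectMatching.sub M-perfect u v

  weight≡1 : weight X (sgn ∘ κ) ≡ + 1
  weight≡1 = trans (tight⇒weight≡sgn κ tight (perfectMatching-⊆ H⊆A M₀-perfect) (separates M₀-perfect)
                                     Xu₀ Xv₀ M₀u₀v₀)
                   (cong sgn (xor-inverseˡ (κ₀ u₀)))

  leaving : ∀ u v → X u ≡ true → X v ≡ false → H u v ≡ true → κ u ≡ true
  leaving u v Xu Xv Huv with H-covered u v Huv
  ... | M , M-perfect , Muv = sgn≡1⇒true (trans (sym weight≡sgn) weight≡1)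
    where
    weight≡sgn : weight X (sgn ∘ κ) ≡ sgn (κ u)
    weight≡sgn = tight⇒weight≡sgn κ tight (perfectMatching-⊆ H⊆A M-perfect) (separates M-perfect) Xu Xv Muv

  sameColour : Fin n → VSet n
  sameColour p w = not (κ p) xor κ w

  sameColour-false : ∀ {p w} → sameColour p w ≡ false → κ w ≡ not (κ p)
  sameColour-false {p} {w} = xor≡false⇒≡ {not (κ p)} {κ w}

  sameColour-true : ∀ {p w} → κ w ≡ κ p → sameColour p w ≡ true
  sameColour-true {p} κw≡κp rewrite κw≡κp = xor-inverseˡ (κ p)

  other-removed-edge : ∀ {p q r t} → (∀ u v → A u v ≡ H u v ∨ isPair p q u v ∨ isPair r t u v) →
                       A p q ≡ true → κ q ≡ κ p → κ r ≡ not (κ p) × κ t ≡ not (κ p)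
  other-removed-edge {p} {q} {r} {t} union Apq κq≡κp
    with opposite-monochromatic-edge (sameColour p) (perfectMatching-⊆ H⊆A M₀-perfect)
           (λ u v M₀uv → xorˡ-≢ {κ u} {κ v} (not (κ p)) (separates M₀-perfect u v M₀uv))
           A-covered Apq (sameColour-true refl) (sameColour-true κq≡κp)
  ... | u , v , Tu , Tv , Auv with ∨₃-true (trans (sym (union u v)) Auv)
  ... | inj₁ Huv      = ⊥-elim (κ-proper u v Huv (trans (sameColour-false Tu) (sym (sameColour-false Tv))))
  ... | inj₂ (inj₁ e) = ⊥-elim (not-¬ (isPair-elim (λ x _ → κ x ≡ κ p) e refl κq≡κp) (sameColour-false Tu))
  ... | inj₂ (inj₂ e) =
    isPair-elim (λ x y → κ x ≡ not (κ p) → κ y ≡ not (κ p) → κ r ≡ not (κ p) × κ t ≡ not (κ p))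
                e _,_ (flip _,_) (sameColour-false Tu) (sameColour-false Tv)

  monochromatic-removed-edge : κ b ≡ κ a ⊎ κ d ≡ κ c
  monochromatic-removed-edge with κ b ≟ᵇ κ a | κ d ≟ᵇ κ c
  ... | yes κb≡κa | _         = inj₁ κb≡κa
  ... | no _      | yes κd≡κc = inj₂ κd≡κc
  ... | no κb≢κa  | no κd≢κc  = ⊥-elim (A-nonbipartite (κ , κ-proper-A))
    where
    κ-proper-A : Proper A κ
    κ-proper-A u v Auv with ∨₃-true (trans (sym (A-union u v)) Auv)
    ... | inj₁ Huv      = κ-proper u v Huv
    ... | inj₂ (inj₁ e) = isPair-elim (λ x y → κ x ≢ κ y) e (κb≢κa ∘ sym) κb≢κa
    ... | inj₂ (inj₂ e) = isPair-elim (λ x y → κ x ≢ κ y) e (κd≢κc ∘ sym) κd≢κc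

  RemovedEdgeColours : Fin n → Fin n → Fin n → Fin n → Set
  RemovedEdgeColours p q r t = κ p ≡ true × κ q ≡ true × κ r ≡ false × κ t ≡ false

  orient : ∀ {p q r t} → κ q ≡ κ p → κ r ≡ not (κ p) × κ t ≡ not (κ p) →
           RemovedEdgeColours p q r t ⊎ RemovedEdgeColours r t p q
  orient κq≡κp (κr , κt) = by-colour κq≡κp κr κt
    where
    by-colour : ∀ {x y z w} → y ≡ x → z ≡ not x → w ≡ not x →
                (x ≡ true × y ≡ true × z ≡ false × w ≡ false) ⊎
                (z ≡ true × w ≡ true × x ≡ false × y ≡ false)
    by-colour {true}  y≡x z w = inj₁ (refl , y≡x , z , w)
    by-colour {false} y≡x z w = inj₂ (z , w , refl , y≡x)

  removed-edge-colours : RemovedEdgeColours a b c d ⊎ RemovedEdgeColours c d a b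
  removed-edge-colours with monochromatic-removed-edge
  ... | inj₁ κb≡κa = orient κb≡κa (other-removed-edge A-union Aab κb≡κa)
  ... | inj₂ κd≡κc = swap (orient κd≡κc (other-removed-edge A-union′ Acd κd≡κc))

  contraction-bipartite : BipartiteRel (contractAdj A X) ⊎ BipartiteRel (contractAdj A (complement X))
  contraction-bipartite with removed-edge-colours
  ... | inj₁ (κa , κb , κc , κd) =
    RemovedEdges.contraction-bipartite A-sym cubic cut≡3 A-union (edge-ends-≢ Aab) (edge-ends-≢ Acd)
      H-sym κ-proper κa κb κc κd leaving weight≡1
  ... | inj₂ (κc , κd , κa , κb) =
    RemovedEdges.contraction-bipartite A-sym cubic cut≡3 A-union′ (edge-ends-≢ Acd) (edge-ends-≢ Aab)
      H-sym κ-proper κc κd κa κb leaving weight≡1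

tight⇒bipartite-contraction : ∀ {n} {A : Adj n} {X : VSet n} → IsSimple A → NearBipartite A → Cubic A →
  NonTrivial X → cutCount X A ≡ 3 → Tight A X →
  BipartiteRel (contractAdj A X) ⊎ BipartiteRel (contractAdj A (complement X))
tight⇒bipartite-contraction {n} {A} {X} simple
  (A-nonbipartite , (_ , A-covered) , a , b , c , d , Aab , Acd , (κ₀ , κ₀-proper) , (H-connected , H-covered))
  cubic (X≥2 , X̄≥2) cut≡3 tight
  with size-witness X X≥2 | size-witness (complement X) X̄≥2
... | x , Xx | y , X̄y
  with reach-edge (H-connected x y) (λ x≡y → true≢false (trans (sym Xx) (trans (cong X x≡y) (not-true X̄y))))
... | h , h′ , Hhh′
  with H-covered h h′ Hhh′
... | M₀ , M₀-perfect , _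
  with pairCount-witness (λ u v → X u ∧ not (X v) ∧ M₀ u v)
         (subst (0 <_) (sym (tight M₀ (perfectMatching-⊆ (delete2-⊆ {a = a} {b} {c} {d}) M₀-perfect)))
                (s≤s ℕ.z≤n))
... | u₀ , v₀ , e = let (Xu₀ , e′) = ∧-true e ; (X̄v₀ , M₀u₀v₀) = ∧-true e′ in
  TightCut.contraction-bipartite simple cubic cut≡3 tight A-nonbipartite A-covered Aab Acd
    κ₀ κ₀-proper H-covered M₀-perfect Xu₀ (not-true X̄v₀) M₀u₀v₀

corollary4p2 : ∀ {n : ℕ} (A : Adj n) → IsSimple A → ThreeEdgeConnected A →
                   NearBipartite A → Cubic A →
                   (X : VSet n) → NonTrivial X → cutCount X A ≡ 3 →
                   (Tight A X ⇔
                     (BipartiteRel (contractAdj A X) ⊎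
                      BipartiteRel (contractAdj A (complement X))))
-- The argument does not use 3-edge-connectivity.
corollary4p2 A simple _ near cubic X nontrivial cut≡3 = mk⇔
  (tight⇒bipartite-contraction simple near cubic nontrivial cut≡3)
  [ bipartite-contraction⇒tight simple cubic cut≡3
  , tight-complement {X = X} ∘ bipartite-contraction⇒tight simple cubic cut-X̄≡3 ]
  where
  cut-X̄≡3 : cutCount (complement X) A ≡ 3
  cut-X̄≡3 = trans (cutCount-complement X A (IsSimple.symm simple)) cut≡3
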